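{- Let $G$ be a finite connected graph with $n$ vertices. Then $wp(G)=1$ if and only if $G$ has at least $2n-2$ edges.
   Context: A configuration of pebbles on a graph $G$ is a function $C:V(G)\to\mathbb{N}$; its size is $\sum_{v}C(v)$. A weight distribution $W$ on $G$ assigns to each edge $e$ a weight $w_e$ with $0\le w_e\le 1$; its total weight is $|W|=\sum_{e\in E(G)}w_e$, and $G_W$ denotes the resulting weighted graph. A pebbling step along an edge $uv$ of weight $w$ removes $k$ pebbles from $u$ (for some positive integer $k$ not exceeding the number of pebbles on $u$) and adds $\lfloor wk\rfloor$ pebbles to $v$. A target vertex $t$ can be reached from a configuration $C$ if some sequence of pebbling steps yields a configuration with at least one pebble on $t$. $G_W$ is $p$-solvable if every configuration of $p$ pebbles can reach every target vertex. The weighted pebbling number $wp(G)$ of the unweighted graph $G$ is the smallest positive integer $p$ for which there exists a weight distribution $W$ on $G$ with $|W|=|E(G)|/2$ such that $G_W$ is $p$-solvable.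
   Formalization: The edge weights $w_e$ of every weight distribution take values in the rationals. -}

module Defs where

open import Data.Nat using (ℕ; zero; suc; _≤_; _∸_; _<ᵇ_)
open import Data.Bool using (Bool; true; false; if_then_else_; _∧_)
open import Data.Fin using (Fin; toℕ)
open import Data.Fin.Properties using (_≟_)
open import Data.List using (List; []; _∷_; concatMap; allFin; foldr; length; map)
open import Data.Nat.ListAction using (sum)
open import Data.Product using (_×_; _,_; ∃; Σ)
open import Data.Integer using (+_; ∣_∣)
open import Data.Rational using (ℚ; floor; _/_; 0ℚ; 1ℚ) renaming (_≤_ to _≤ℚ_; _+_ to _+ℚ_; _*_ to _*ℚ_)
import Data.Rational as ℚ
open import Relation.Nullary using (does; ¬_)
open import Relation.Binary.PropositionalEquality using (_≡_)
open import Relation.Binary.Construct.Closure.ReflexiveTransitive using (Star)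
open import Data.List.Membership.Propositional using (_∈_)

record Graph (n : ℕ) : Set where
  field
    adj    : Fin n → Fin n → Bool
    sym    : ∀ u v → adj u v ≡ adj v u
    irrefl : ∀ u → adj u u ≡ false
open Graph public

Connected : ∀ {n} → Graph n → Set
Connected G = ∀ u v → Star (λ a b → adj G a b ≡ true) u v

edges : ∀ {n} → Graph n → List (Fin n × Fin n)
edges {n} G = concatMap (λ i → concatMap (λ j →
  if (toℕ i <ᵇ toℕ j) ∧ adj G i j then (i , j) ∷ [] else []) (allFin n)) (allFin n)

numEdges : ∀ {n} → Graph n → ℕ
numEdges G = length (edges G)

-- A weight distribution: weights indexed by the canonical pair (i , j), i < j
-- (only the values on edges of G matter).
Weights : ℕ → Set
Weights n = Fin n → Fin n → ℚ

wt : ∀ {n} → Weights n → Fin n → Fin n → ℚ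
wt W u v = if toℕ u <ᵇ toℕ v then W u v else W v u

ValidWeights : ∀ {n} → Graph n → Weights n → Set
ValidWeights G W = ∀ {i j} → (i , j) ∈ edges G → (0ℚ ≤ℚ W i j) × (W i j ≤ℚ 1ℚ)

totalWeight : ∀ {n} → Graph n → Weights n → ℚ
totalWeight G W = foldr _+ℚ_ 0ℚ (map (λ e → W (Data.Product.proj₁ e) (Data.Product.proj₂ e)) (edges G))

HalfWeight : ∀ {n} → Graph n → Weights n → Set
HalfWeight G W = totalWeight G W ≡ (+ numEdges G) / 2

Config : ℕ → Set
Config n = Fin n → ℕ

size : ∀ {n} → Config n → ℕ
size {n} C = sum (map C (allFin n))

move : ∀ {n} → Config n → Fin n → Fin n → ℕ → ℚ → Config n
move C u v k w x =
  if does (x ≟ u) then C x ∸ k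
  else if does (x ≟ v) then C x Data.Nat.+ ∣ floor (w *ℚ (+ k / 1)) ∣
  else C x

data Step {n} (G : Graph n) (W : Weights n) : Config n → Config n → Set where
  step : ∀ C u v k → adj G u v ≡ true → 1 ≤ k → k ≤ C u →
         Step G W C (move C u v k (wt W u v))

CanReach : ∀ {n} → Graph n → Weights n → Config n → Fin n → Set
CanReach G W C t = ∃ λ C' → Star (Step G W) C C' × (1 ≤ C' t)

Solvable : ∀ {n} → Graph n → Weights n → ℕ → Set
Solvable {n} G W p = ∀ (C : Config n) → size C ≡ p → ∀ t → CanReach G W C t

WSolvable : ∀ {n} → Graph n → ℕ → Set
WSolvable {n} G p = Σ (Weights n) λ W → ValidWeights G W × HalfWeight G W × Solvable G W p

IsWP : ∀ {n} → Graph n → ℕ → Set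
IsWP G p = (1 ≤ p) × WSolvable G p × (∀ q → 1 ≤ q → suc q ≤ p → ¬ WSolvable G q)

module Submission where

-- A single pebble crossing an edge of weight w < 1 is destroyed (⌊w⌋ = 0),
-- so one pebble reaches every target exactly when the edges of weight 1
-- ("full edges") connect all vertices.  Both directions of the theorem then
-- reduce to counting edges of a spanning forest:
--   * necessity: full edges connecting n vertices number at least n − 1, and
--     as weights are nonnegative they contribute at most |W| = |E|/2;
--   * sufficiency: put weight 1 on a spanning tree (n − 1 ≤ |E|/2 edges) and
--     spread the remaining weight uniformly over the other edges.
-- The spanning forest is produced by Kruskal's algorithm on a labelling of
-- the vertices by class representatives; the number of classes (fixed points
-- of the labelling) drops by one with every kept edge, which yields both
-- "connected ⇒ at least n − 1 edges" and "a spanning tree has n − 1 edges".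

open import Data.Nat using (ℕ; zero; suc; _+_; _*_; _∸_; _≤_; _<_; z≤n; s≤s; _<ᵇ_)
import Data.Nat.Properties as ℕP
open import Data.Nat.DivMod using (m<n⇒m/n≡0)
open import Data.Nat.Tactic.RingSolver using (solve-∀)
import Data.Nat.ListAction as ListAction
open import Data.Integer as ℤ using (+_; -[1+_]; ∣_∣)
import Data.Integer.Properties as ℤP
open import Data.Rational using (ℚ; mkℚ; _/_; floor; toℚᵘ; 0ℚ; 1ℚ; ½) renaming (_+_ to _+ℚ_; _*_ to _*ℚ_; _≤_ to _≤ℚ_; _<_ to _<ℚ_)
open import Data.Rational.Literals using (fromℤ)
import Data.Rational.Properties as ℚP
open import Data.Rational.Solver using (module +-*-Solver)
open import Data.Rational.Unnormalised as ℚᵘ using (mkℚᵘ; *≤*)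
import Data.Rational.Unnormalised.Properties as ℚᵘP
open import Data.Bool using (Bool; true; false; if_then_else_; _∧_)
open import Data.Bool.Properties using (T-∧; T-≡)
open import Data.Fin using (Fin; zero; suc; toℕ)
open import Data.Fin.Properties using (_≟_; toℕ-injective)
open import Data.List using (List; []; _∷_; length; filter; filterᵇ; foldr; map; allFin; tabulate; concatMap; cartesianProduct; _++_)
open import Data.List.Properties using (map-tabulate; filter-++; filter-accept; filter-reject)
open import Data.List.Membership.Propositional using (_∈_; _∉_)
open import Data.List.Membership.Propositional.Properties using (∈-filter⁺; ∈-filter⁻; ∈-cartesianProduct⁺; ∈-allFin)
import Data.List.Membership.DecPropositional as DecMembership
import Data.List.Relation.Unary.All as All
open import Data.List.Relation.Unary.Any using (here; there)
open import Data.List.Relation.Unary.Unique.Propositional using (Unique)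
open import Data.List.Relation.Unary.AllPairs using ([]; _∷_)
open import Data.List.Relation.Unary.Unique.Propositional.Properties using (filter⁺; cartesianProduct⁺; allFin⁺)
open import Data.List.Relation.Binary.Sublist.Propositional using (_⊆_; []; _∷_; _∷ʳ_; lookup)
open import Data.List.Relation.Binary.Sublist.Heterogeneous.Properties using (length-mono-≤)
open import Data.Product using (Σ; ∃; _×_; _,_; proj₁; proj₂; uncurry)
open import Data.Product.Properties using (≡-dec)
open import Data.Sum using (_⊎_; inj₁; inj₂)
open import Data.Empty using (⊥-elim)
open import Function.Base using (_∘_)
open import Function.Bundles using (Equivalence)
open import Relation.Nullary using (¬_; does; yes; no; ¬?)
open import Relation.Nullary.Decidable using (T?; dec-true; dec-false)
open import Relation.Unary using (Decidable)
open import Relation.Binary.Definitions using (Symmetric; DecidableEquality; tri<; tri≈; tri>)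
open import Relation.Binary.PropositionalEquality
open import Relation.Binary.Construct.Closure.ReflexiveTransitive using (Star; ε; _◅_; _◅◅_)
import Algebra.Properties.CommutativeMonoid.Sum as CommutativeMonoidSum
open CommutativeMonoidSum ℕP.+-0-commutativeMonoid using (sum-cong-≗; ∑-distrib-+; sum-replicate-zero) renaming (sum to ∑)

open import Defs hiding (sym)

δ : ∀ {n} → Fin n → Fin n → ℕ
δ p x = if does (x ≟ p) then 1 else 0

δ-self : ∀ {n} (p : Fin n) → δ p p ≡ 1
δ-self p rewrite dec-true (p ≟ p) refl = refl

δ-other : ∀ {n} {p x : Fin n} → x ≢ p → δ p x ≡ 0
δ-other {p = p} {x} x≢p rewrite dec-false (x ≟ p) x≢p = refl

size≡∑ : ∀ {n} (C : Config n) → size C ≡ ∑ C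
size≡∑ C = trans (cong ListAction.sum (map-tabulate (λ x → x) C)) (list-sum C)
  where
  list-sum : ∀ {m} (f : Fin m → ℕ) → ListAction.sum (tabulate f) ≡ ∑ f
  list-sum {zero} f = refl
  list-sum {suc m} f = cong (_+_ (f zero)) (list-sum (f ∘ suc))

∑-δ : ∀ {n} (p : Fin n) → ∑ (δ p) ≡ 1
∑-δ {suc n} zero = cong suc (sum-replicate-zero n)
∑-δ {suc n} (suc p) = ∑-δ p

∑-ones : ∀ n → ∑ {n} (λ _ → 1) ≡ n
∑-ones zero = refl
∑-ones (suc n) = cong suc (∑-ones n)

∑-pos : ∀ {n} (f : Fin n → ℕ) → 1 ≤ ∑ f → ∃ λ x → 1 ≤ f x
∑-pos {suc n} f pos with f zero in eq
... | suc _ = zero , subst (1 ≤_) (sym eq) (s≤s z≤n)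
... | zero with ∑-pos (f ∘ suc) pos
...   | x , 1≤fx = suc x , 1≤fx

count : ∀ {A : Set} {P : A → Set} → Decidable P → List A → ℕ
count P? xs = length (filter P? xs)

module _ {A : Set} where

  count-split : ∀ {P : A → Set} (P? : Decidable P) xs →
    count P? xs + count (¬? ∘ P?) xs ≡ length xs
  count-split P? [] = refl
  count-split P? (x ∷ xs) with does (P? x)
  ... | true = cong suc (count-split P? xs)
  ... | false = trans (ℕP.+-suc _ _) (cong suc (count-split P? xs))

  count-mono : ∀ {P Q : A → Set} (P? : Decidable P) (Q? : Decidable Q) xs →
    (∀ {x} → x ∈ xs → P x → Q x) → count P? xs ≤ count Q? xs
  count-mono P? Q? [] P⇒Q = z≤n
  count-mono P? Q? (x ∷ xs) P⇒Q with P? x | Q? x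
  ... | yes _ | yes _ = s≤s (count-mono P? Q? xs (P⇒Q ∘ there))
  ... | yes p | no ¬q = ⊥-elim (¬q (P⇒Q (here refl) p))
  ... | no _ | yes _ = ℕP.m≤n⇒m≤1+n (count-mono P? Q? xs (P⇒Q ∘ there))
  ... | no _ | no _ = count-mono P? Q? xs (P⇒Q ∘ there)

  module _ (_≟ₐ_ : DecidableEquality A) where
    open DecMembership _≟ₐ_ using (_∈?_)

    count-∈-sublist : ∀ {ys xs} → ys ⊆ xs → Unique xs → count (_∈? ys) xs ≤ length ys
    count-∈-sublist [] [] = z≤n
    count-∈-sublist {ys} (x ∷ʳ ys⊆xs) (x∉xs ∷ u) =
      subst (_≤ length ys) (sym (cong length (filter-reject (_∈? ys) x∉ys)))
        (count-∈-sublist ys⊆xs u)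
      where
      x∉ys : x ∉ ys
      x∉ys x∈ys = All.lookup x∉xs (lookup ys⊆xs x∈ys) refl
    count-∈-sublist {x ∷ ys} {x ∷ xs} (refl ∷ ys⊆xs) (x∉xs ∷ u) =
      subst (_≤ suc (length ys)) (sym (cong length (filter-accept (_∈? (x ∷ ys)) (here refl))))
        (s≤s (ℕP.≤-trans (count-mono (_∈? (x ∷ ys)) (_∈? ys) xs drop-x) (count-∈-sublist ys⊆xs u)))
      where
      drop-x : ∀ {y} → y ∈ xs → y ∈ x ∷ ys → y ∈ ys
      drop-x y∈xs (here refl) = ⊥-elim (All.lookup x∉xs y∈xs refl)
      drop-x _ (there y∈ys) = y∈ys

-- A labelling maps each vertex to the representative of its class; it is
-- idempotent when representatives label themselves.  The classes of an
-- idempotent labelling are counted by its fixed points, the roots.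
Labelling : ℕ → Set
Labelling n = Fin n → Fin n

Idempotent : ∀ {n} → Labelling n → Set
Idempotent c = ∀ x → c (c x) ≡ c x

isRoot : ∀ {n} → Labelling n → Fin n → ℕ
isRoot c x = if does (c x ≟ x) then 1 else 0

roots : ∀ {n} → Labelling n → ℕ
roots c = ∑ (isRoot c)

merge : ∀ {n} → Labelling n → Fin n → Fin n → Labelling n
merge c a b x = if does (c x ≟ c a) then c b else c x

module _ {n : ℕ} (c : Labelling n) (a b : Fin n) where

  merge-idempotent : Idempotent c → Idempotent (merge c a b)
  merge-idempotent idem x with c x ≟ c a
  ... | yes _ with c (c b) ≟ c a
  ...   | yes _ = refl
  ...   | no _ = idem b
  merge-idempotent idem x | no cx≢ca rewrite idem x | dec-false (c x ≟ c a) cx≢ca = refl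

  merge-joins : merge c a b a ≡ merge c a b b
  merge-joins rewrite dec-true (c a ≟ c a) refl with c b ≟ c a
  ... | yes _ = refl
  ... | no _ = refl

  merge-coarsens : ∀ {x y} → c x ≡ c y → merge c a b x ≡ merge c a b y
  merge-coarsens eq rewrite eq = refl

  merge-cases : ∀ x y → merge c a b x ≡ merge c a b y →
    c x ≡ c y ⊎ (c x ≡ c a × c y ≡ c b) ⊎ (c x ≡ c b × c y ≡ c a)
  merge-cases x y eq with c x ≟ c a | c y ≟ c a
  ... | yes xa | yes ya = inj₁ (trans xa (sym ya))
  ... | yes xa | no _ = inj₂ (inj₁ (xa , sym eq))
  ... | no _ | yes ya = inj₂ (inj₂ (eq , ya))
  ... | no _ | no _ = inj₁ eq

  roots-merge : Idempotent c → c a ≢ c b → roots c ≡ suc (roots (merge c a b))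
  roots-merge idem ca≢cb = begin
    roots c                                       ≡⟨ sum-cong-≗ root-of-c ⟩
    ∑ (λ x → δ (c a) x + isRoot (merge c a b) x)  ≡⟨ ∑-distrib-+ (δ (c a)) (isRoot (merge c a b)) ⟩
    ∑ (δ (c a)) + roots (merge c a b)             ≡⟨ cong (_+ roots (merge c a b)) (∑-δ (c a)) ⟩
    suc (roots (merge c a b))                     ∎
    where
    open ≡-Reasoning
    cb≢ca : c b ≢ c a
    cb≢ca = ca≢cb ∘ sym
    root-of-c : ∀ x → isRoot c x ≡ δ (c a) x + isRoot (merge c a b) x
    root-of-c x with x ≟ c a
    ... | yes refl rewrite idem a | dec-true (c a ≟ c a) refl | dec-false (c b ≟ c a) cb≢ca = refl
    ... | no x≢ca with c x ≟ c a
    ...   | no _ = refl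
    ...   | yes cx≡ca
      rewrite dec-false (c x ≟ x) (λ cx≡x → x≢ca (trans (sym cx≡x) cx≡ca))
            | dec-false (c b ≟ x) (λ cb≡x → cb≢ca (trans (sym (idem b)) (trans (cong c cb≡x) cx≡ca))) = refl

roots-id : ∀ n → roots {n} (λ x → x) ≡ n
roots-id n = trans (sum-cong-≗ {n} δ-self) (∑-ones n)

roots-single : ∀ {n} (c : Labelling n) → Idempotent c → (∀ x y → c x ≡ c y) →
  (x₀ : Fin n) → roots c ≡ 1
roots-single c idem single x₀ = trans (sum-cong-≗ root-is-cx₀) (∑-δ (c x₀))
  where
  root-is-cx₀ : ∀ x → isRoot c x ≡ δ (c x₀) x
  root-is-cx₀ x with c x ≟ x | x ≟ c x₀
  ... | yes _ | yes _ = refl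
  ... | no _ | no _ = refl
  ... | yes cx≡x | no x≢cx₀ = ⊥-elim (x≢cx₀ (trans (sym cx≡x) (single x x₀)))
  ... | no cx≢x | yes refl = ⊥-elim (cx≢x (idem x₀))

forestLabel : ∀ {n} → Labelling n → List (Fin n × Fin n) → Labelling n
forestLabel c [] = c
forestLabel c ((a , b) ∷ es) =
  if does (c a ≟ c b) then forestLabel c es else forestLabel (merge c a b) es

forestEdges : ∀ {n} → Labelling n → List (Fin n × Fin n) → List (Fin n × Fin n)
forestEdges c [] = []
forestEdges c ((a , b) ∷ es) =
  if does (c a ≟ c b) then forestEdges c es else (a , b) ∷ forestEdges (merge c a b) es

Spans : ∀ {n} → Labelling n → (Fin n → Fin n → Set) → Set
Spans {n} c R = ∀ (x y : Fin n) → c x ≡ c y → Star R x y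

module _ {n : ℕ} where

  forest-idempotent : ∀ (c : Labelling n) es → Idempotent c → Idempotent (forestLabel c es)
  forest-idempotent c [] idem = idem
  forest-idempotent c ((a , b) ∷ es) idem with c a ≟ c b
  ... | yes _ = forest-idempotent c es idem
  ... | no _ = forest-idempotent (merge c a b) es (merge-idempotent c a b idem)

  forest-coarsens : ∀ (c : Labelling n) es {x y} → c x ≡ c y →
    forestLabel c es x ≡ forestLabel c es y
  forest-coarsens c [] eq = eq
  forest-coarsens c ((a , b) ∷ es) eq with c a ≟ c b
  ... | yes _ = forest-coarsens c es eq
  ... | no _ = forest-coarsens (merge c a b) es (merge-coarsens c a b eq)

  forest-joins : ∀ (c : Labelling n) es {a b} → (a , b) ∈ es →
    forestLabel c es a ≡ forestLabel c es b
  forest-joins c ((a , b) ∷ es) (here refl) with c a ≟ c b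
  ... | yes ca≡cb = forest-coarsens c es ca≡cb
  ... | no _ = forest-coarsens (merge c a b) es (merge-joins c a b)
  forest-joins c ((a , b) ∷ es) (there e∈es) with c a ≟ c b
  ... | yes _ = forest-joins c es e∈es
  ... | no _ = forest-joins (merge c a b) es e∈es

  forest-sublist : ∀ (c : Labelling n) es → forestEdges c es ⊆ es
  forest-sublist c [] = []
  forest-sublist c ((a , b) ∷ es) with c a ≟ c b
  ... | yes _ = (a , b) ∷ʳ forest-sublist c es
  ... | no _ = refl ∷ forest-sublist (merge c a b) es

  forest-roots : ∀ (c : Labelling n) es → Idempotent c →
    roots c ≡ length (forestEdges c es) + roots (forestLabel c es)
  forest-roots c [] idem = refl
  forest-roots c ((a , b) ∷ es) idem with c a ≟ c b
  ... | yes _ = forest-roots c es idem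
  ... | no ca≢cb = trans (roots-merge c a b idem ca≢cb)
                         (cong suc (forest-roots (merge c a b) es (merge-idempotent c a b idem)))

  merge-spans : ∀ {R : Fin n → Fin n → Set} → Symmetric R → ∀ c a b →
    Spans c R → R a b → Spans (merge c a b) R
  merge-spans sym-R c a b spans ab x y eq with merge-cases c a b x y eq
  ... | inj₁ cx≡cy = spans x y cx≡cy
  ... | inj₂ (inj₁ (cx≡ca , cy≡cb)) = spans x a cx≡ca ◅◅ (ab ◅ spans b y (sym cy≡cb))
  ... | inj₂ (inj₂ (cx≡cb , cy≡ca)) = spans x b cx≡cb ◅◅ (sym-R ab ◅ spans a y (sym cy≡ca))

  forest-spans : ∀ {R : Fin n → Fin n → Set} → Symmetric R → ∀ (c : Labelling n) es →
    Spans c R → (∀ {a b} → (a , b) ∈ forestEdges c es → R a b) → Spans (forestLabel c es) R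
  forest-spans sym-R c [] spans kept = spans
  forest-spans sym-R c ((a , b) ∷ es) spans kept with c a ≟ c b
  ... | yes _ = forest-spans sym-R c es spans kept
  ... | no _ = forest-spans sym-R (merge c a b) es
                 (merge-spans sym-R c a b spans (kept (here refl))) (λ e∈ → kept (there e∈))

  star-joins : ∀ {R : Fin n → Fin n → Set} (c : Labelling n) →
    (∀ {a b} → R a b → c a ≡ c b) → ∀ {x y} → Star R x y → c x ≡ c y
  star-joins c joins ε = refl
  star-joins c joins (r ◅ rs) = trans (joins r) (star-joins c joins rs)

-- When Kruskal, started from the discrete labelling, ends with a single
-- class, it keeps exactly n ∸ 1 edges: the n roots it starts with are
-- reduced to one (or to none when n = 0).
spanning-forest-size : ∀ {n} (es : List (Fin n × Fin n)) →
  (∀ x y → forestLabel (λ v → v) es x ≡ forestLabel (λ v → v) es y) →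
  length (forestEdges (λ v → v) es) ≡ n ∸ 1
spanning-forest-size {n} es single = kept≡ n refl
  where
  open ≡-Reasoning
  kept = length (forestEdges (λ v → v) es)
  final = forestLabel (λ v → v) es
  balance : n ≡ kept + roots final
  balance = trans (sym (roots-id n)) (forest-roots (λ v → v) es (λ _ → refl))
  kept≡ : ∀ m → m ≡ n → kept ≡ m ∸ 1
  kept≡ zero refl = ℕP.n≤0⇒n≡0 (ℕP.m+n≤o⇒m≤o kept (ℕP.≤-reflexive (sym balance)))
  kept≡ (suc m) refl = begin
    kept                   ≡⟨ ℕP.m+n∸n≡m kept 1 ⟨
    kept + 1 ∸ 1           ≡⟨ cong (λ k → kept + k ∸ 1) (roots-single final idem single zero) ⟨
    kept + roots final ∸ 1 ≡⟨ cong (_∸ 1) balance ⟨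
    suc m ∸ 1              ∎
    where idem = forest-idempotent (λ v → v) es (λ _ → refl)

-- The edge list of a graph is the list of all vertex pairs filtered by
-- "i < j and ij is an edge"; this gives its membership and uniqueness.
concatMap-as-filter : ∀ {A B : Set} (p : A → B → Bool) (xs : List A) (ys : List B) →
  concatMap (λ i → concatMap (λ j → if p i j then (i , j) ∷ [] else []) ys) xs
    ≡ filterᵇ (uncurry p) (cartesianProduct xs ys)
concatMap-as-filter p [] ys = refl
concatMap-as-filter p (x ∷ xs) ys = begin
  row ys ++ _
    ≡⟨ cong₂ _++_ (row-as-filter ys) (concatMap-as-filter p xs ys) ⟩
  filterᵇ (uncurry p) (map (x ,_) ys) ++ filterᵇ (uncurry p) (cartesianProduct xs ys)
    ≡⟨ filter-++ (T? ∘ uncurry p) (map (x ,_) ys) (cartesianProduct xs ys) ⟨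
  filterᵇ (uncurry p) (cartesianProduct (x ∷ xs) ys) ∎
  where
  open ≡-Reasoning
  row : List _ → List _
  row = concatMap (λ j → if p x j then (x , j) ∷ [] else [])
  row-as-filter : ∀ ys → row ys ≡ filterᵇ (uncurry p) (map (x ,_) ys)
  row-as-filter [] = refl
  row-as-filter (y ∷ ys) with p x y
  ... | true = cong ((x , y) ∷_) (row-as-filter ys)
  ... | false = row-as-filter ys

wt-ordered : ∀ {n} (W : Weights n) {i j} → toℕ i < toℕ j → wt W i j ≡ W i j × wt W j i ≡ W i j
wt-ordered W {i} {j} i<j rewrite Equivalence.to T-≡ (ℕP.<⇒<ᵇ i<j) with toℕ j <ᵇ toℕ i in j<ᵇi
... | false = refl , refl
... | true = ⊥-elim (ℕP.<-asym i<j (ℕP.<ᵇ⇒< _ _ (Equivalence.from T-≡ j<ᵇi)))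

module _ {n : ℕ} (G : Graph n) where

  private
    ordered : Fin n → Fin n → Bool
    ordered i j = (toℕ i <ᵇ toℕ j) ∧ adj G i j

    allPairs : List (Fin n × Fin n)
    allPairs = cartesianProduct (allFin n) (allFin n)

    edges≡filter : edges G ≡ filterᵇ (uncurry ordered) allPairs
    edges≡filter = concatMap-as-filter ordered (allFin n) (allFin n)

  edges-unique : Unique (edges G)
  edges-unique rewrite edges≡filter = filter⁺ _ (cartesianProduct⁺ (allFin⁺ n) (allFin⁺ n))

  ∈-edges⁻ : ∀ {i j} → (i , j) ∈ edges G → toℕ i < toℕ j × adj G i j ≡ true
  ∈-edges⁻ ij∈E rewrite edges≡filter
    with Equivalence.to T-∧ (proj₂ (∈-filter⁻ (T? ∘ uncurry ordered) {xs = allPairs} ij∈E))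
  ... | i<ᵇj , ij = ℕP.<ᵇ⇒< _ _ i<ᵇj , Equivalence.to T-≡ ij

  ∈-edges⁺ : ∀ {i j} → toℕ i < toℕ j → adj G i j ≡ true → (i , j) ∈ edges G
  ∈-edges⁺ {i} {j} i<j ij rewrite edges≡filter =
    ∈-filter⁺ (T? ∘ uncurry ordered) (∈-cartesianProduct⁺ (∈-allFin i) (∈-allFin j))
      (Equivalence.from T-∧ (ℕP.<⇒<ᵇ i<j , Equivalence.from T-≡ ij))

  orient : ∀ {a b} → adj G a b ≡ true → (a , b) ∈ edges G ⊎ (b , a) ∈ edges G
  orient {a} {b} ab with ℕP.<-cmp (toℕ a) (toℕ b)
  ... | tri< a<b _ _ = inj₁ (∈-edges⁺ a<b ab)
  ... | tri> _ _ b<a = inj₂ (∈-edges⁺ b<a (trans (Graph.sym G b a) ab))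
  ... | tri≈ _ a≡b _ with toℕ-injective a≡b
  ...   | refl with trans (sym ab) (irrefl G a)
  ...     | ()

  wt-edge : ∀ (W : Weights n) {i j} → (i , j) ∈ edges G → wt W i j ≡ W i j × wt W j i ≡ W i j
  wt-edge W ij∈E = wt-ordered W (proj₁ (∈-edges⁻ ij∈E))

  wt-sym : ∀ (W : Weights n) {a b} → adj G a b ≡ true → wt W a b ≡ wt W b a
  wt-sym W ab with orient ab
  ... | inj₁ ab∈E = trans (proj₁ (wt-edge W ab∈E)) (sym (proj₂ (wt-edge W ab∈E)))
  ... | inj₂ ba∈E = trans (proj₂ (wt-edge W ba∈E)) (sym (proj₁ (wt-edge W ba∈E)))

ι : ℕ → ℚ
ι k = fromℤ (+ k)

ι-+ : ∀ m n → ι (m + n) ≡ ι m +ℚ ι n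
ι-+ m n = ℚP.toℚᵘ-injective (ℚᵘP.≃-trans (ℚᵘP.≃-reflexive (cong (λ z → mkℚᵘ z 0) numerators))
                                         (ℚᵘP.≃-sym (ℚP.toℚᵘ-homo-+ (ι m) (ι n))))
  where
  numerators : + (m + n) ≡ + m ℤ.* + 1 ℤ.+ + n ℤ.* + 1
  numerators rewrite ℤP.*-identityʳ (+ m) | ℤP.*-identityʳ (+ n) = ℤP.pos-+ m n

half≡ : ∀ m → + m / 2 ≡ ι m *ℚ ½
half≡ m = ℚP.toℚᵘ-injective (ℚᵘP.≃-trans (ℚP.toℚᵘ-fromℚᵘ (mkℚᵘ (+ m) 1))
            (ℚᵘP.≃-trans (ℚᵘP.≃-reflexive (cong (λ z → mkℚᵘ z 1) (sym (ℤP.*-identityʳ (+ m)))))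
                         (ℚᵘP.≃-sym (ℚP.toℚᵘ-homo-* (ι m) ½))))

ι≤half⇒ : ∀ ℓ m → ι ℓ ≤ℚ + m / 2 → 2 * ℓ ≤ m
ι≤half⇒ ℓ m ℓ≤m/2 with ℚᵘP.≤-respʳ-≃ (ℚP.toℚᵘ-fromℚᵘ (mkℚᵘ (+ m) 1)) (ℚP.toℚᵘ-mono-≤ ℓ≤m/2)
... | *≤* ℓ*2≤m*1 rewrite ℤP.*-identityʳ (+ m) | sym (ℤP.pos-* ℓ 2) =
  subst (_≤ m) (ℕP.*-comm ℓ 2) (ℤP.drop‿+≤+ ℓ*2≤m*1)

transfer : ℚ → ℕ
transfer w = ∣ floor (w *ℚ (+ 1 / 1)) ∣

transfer-<1 : ∀ {w} → 0ℚ ≤ℚ w → w <ℚ 1ℚ → transfer w ≡ 0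
transfer-<1 {w} 0≤w w<1 rewrite ℚP.*-identityʳ w = floor-fraction w 0≤w w<1
  where
  floor-fraction : ∀ w → 0ℚ ≤ℚ w → w <ℚ 1ℚ → ∣ floor w ∣ ≡ 0
  floor-fraction (mkℚ -[1+ k ] d _) 0≤w _ with ℚP.drop-*≤* 0≤w
  ... | ()
  floor-fraction (mkℚ (+ k) d _) _ w<1 with ℚP.drop-*<* w<1
  ... | k*1<1*d rewrite ℤP.*-identityʳ (+ k) | ℤP.*-identityˡ (+ suc d)
                      | m<n⇒m/n≡0 (ℤP.drop‿+<+ k*1<1*d) = refl

sumℚ : ∀ {A : Set} → (A → ℚ) → List A → ℚ
sumℚ f es = foldr _+ℚ_ 0ℚ (map f es)

sumℚ-mono : ∀ {A : Set} (f g : A → ℚ) es → (∀ {e} → e ∈ es → f e ≤ℚ g e) → sumℚ f es ≤ℚ sumℚ g es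
sumℚ-mono f g [] f≤g = ℚP.≤-refl
sumℚ-mono f g (e ∷ es) f≤g = ℚP.+-mono-≤ (f≤g (here refl)) (sumℚ-mono f g es (f≤g ∘ there))

sumℚ-two-valued : ∀ {A : Set} {P : A → Set} (P? : Decidable P) (x y : ℚ) es →
  sumℚ (λ e → if does (P? e) then x else y) es ≡ ι (count P? es) *ℚ x +ℚ ι (count (¬? ∘ P?) es) *ℚ y
sumℚ-two-valued P? x y [] = sym (cong₂ _+ℚ_ (ℚP.*-zeroˡ x) (ℚP.*-zeroˡ y))
sumℚ-two-valued P? x y (e ∷ es) with does (P? e)
... | true rewrite sumℚ-two-valued P? x y es | ι-+ 1 (count P? es) =
  solve 4 (λ x y a b → x :+ (a :* x :+ b :* y) := (con 1ℚ :+ a) :* x :+ b :* y) refl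
    x y (ι (count P? es)) (ι (count (¬? ∘ P?) es))
  where open +-*-Solver
... | false rewrite sumℚ-two-valued P? x y es | ι-+ 1 (count (¬? ∘ P?) es) =
  solve 4 (λ x y a b → y :+ (a :* x :+ b :* y) := a :* x :+ (con 1ℚ :+ b) :* y) refl
    x y (ι (count P? es)) (ι (count (¬? ∘ P?) es))
  where open +-*-Solver

fraction-bounds : ∀ s d → s ≤ suc d → 0ℚ ≤ℚ + s / suc d × + s / suc d ≤ℚ 1ℚ
fraction-bounds s d s≤d+1 = ℚP.toℚᵘ-cancel-≤ (ℚᵘP.≤-respʳ-≃ (ℚᵘP.≃-sym as-ℚᵘ) (*≤* nonneg))
                          , ℚP.toℚᵘ-cancel-≤ (ℚᵘP.≤-respˡ-≃ (ℚᵘP.≃-sym as-ℚᵘ) (*≤* at-most-one))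
  where
  as-ℚᵘ = ℚP.toℚᵘ-fromℚᵘ (mkℚᵘ (+ s) d)
  nonneg : + 0 ℤ.≤ + s ℤ.* + 1
  nonneg rewrite ℤP.*-identityʳ (+ s) = ℤ.+≤+ z≤n
  at-most-one : + s ℤ.* + 1 ℤ.≤ + 1 ℤ.* + suc d
  at-most-one rewrite ℤP.*-identityʳ (+ s) | ℤP.*-identityˡ (+ suc d) = ℤ.+≤+ s≤d+1

-- Given t ≤ r there is c ∈ [0, 1] with t·1 + r·c = (t + r)/2, namely
-- c = (r − t)/(2r), which scales r down to (r − t)/2.  (Below, ½ + ½ is 1ℚ
-- by computation.)
balancing-weight : ∀ t r → t ≤ r →
  Σ ℚ λ c → (0ℚ ≤ℚ c × c ≤ℚ 1ℚ) × ι t *ℚ 1ℚ +ℚ ι r *ℚ c ≡ + (t + r) / 2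
balancing-weight zero zero z≤n = + 0 / 1 , fraction-bounds 0 0 z≤n , refl
balancing-weight t (suc q) t≤r = + s / suc d , fraction-bounds s d s≤d+1 , balanced
  where
  r = suc q
  s = r ∸ t
  d = q + suc q
  s≤d+1 : s ≤ suc d
  s≤d+1 = ℕP.≤-trans (ℕP.m∸n≤m r t) (s≤s (ℕP.m≤m+n q r))
  scaled : ι r *ℚ (+ s / suc d) ≡ ι s *ℚ ½
  scaled = ℚP.toℚᵘ-injective (begin
    toℚᵘ (ι r *ℚ (+ s / suc d))              ≈⟨ ℚP.toℚᵘ-homo-* (ι r) (+ s / suc d) ⟩
    mkℚᵘ (+ r) 0 ℚᵘ.* toℚᵘ (+ s / suc d)     ≈⟨ ℚᵘP.*-congˡ {mkℚᵘ (+ r) 0} (ℚP.toℚᵘ-fromℚᵘ (mkℚᵘ (+ s) d)) ⟩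
    (+ r ℤ.* + s) ℚᵘ./ (1 * suc d)            ≡⟨ ℚᵘP./-cong refl (denominators q) ⟩
    (+ r ℤ.* + s) ℚᵘ./ (r * 2)                ≈⟨ ℚᵘP.*-cancelˡ-/ r ⟩
    + s ℚᵘ./ 2                                ≡⟨ ℚᵘP./-cong (sym (ℤP.*-identityʳ (+ s))) refl ⟩
    toℚᵘ (ι s) ℚᵘ.* toℚᵘ ½                    ≈⟨ ℚP.toℚᵘ-homo-* (ι s) ½ ⟨
    toℚᵘ (ι s *ℚ ½)                           ∎)
    where
    open ℚᵘP.≃-Reasoning
    denominators : ∀ q → 1 * suc (q + suc q) ≡ suc q * 2
    denominators = solve-∀
  balanced : ι t *ℚ 1ℚ +ℚ ι r *ℚ (+ s / suc d) ≡ + (t + r) / 2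
  balanced = begin
    ι t *ℚ 1ℚ +ℚ ι r *ℚ (+ s / suc d) ≡⟨ cong (λ z → ι t *ℚ 1ℚ +ℚ z) scaled ⟩
    ι t *ℚ (½ +ℚ ½) +ℚ ι s *ℚ ½
      ≡⟨ solve 2 (λ a b → a :* (con ½ :+ con ½) :+ b :* con ½ := (a :+ (a :+ b)) :* con ½) refl (ι t) (ι s) ⟩
    (ι t +ℚ (ι t +ℚ ι s)) *ℚ ½        ≡⟨ cong (λ z → (ι t +ℚ z) *ℚ ½) (sym (ι-+ t s)) ⟩
    (ι t +ℚ ι (t + s)) *ℚ ½           ≡⟨ cong (λ z → (ι t +ℚ ι z) *ℚ ½) (ℕP.m+[n∸m]≡n t≤r) ⟩
    (ι t +ℚ ι r) *ℚ ½                 ≡⟨ cong (_*ℚ ½) (sym (ι-+ t r)) ⟩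
    ι (t + r) *ℚ ½                    ≡⟨ sym (half≡ (t + r)) ⟩
    + (t + r) / 2                     ∎
    where
    open ≡-Reasoning
    open +-*-Solver

module _ {n : ℕ} (G : Graph n) (W : Weights n) where

  -- x and y are joined by an edge of weight 1: the only edges along which a
  -- lone pebble survives.
  FullEdge : Fin n → Fin n → Set
  FullEdge x y = adj G x y ≡ true × wt W x y ≡ 1ℚ

  full-sym : Symmetric FullEdge
  full-sym {x} {y} (xy , w≡1) = trans (Graph.sym G y x) xy , trans (sym (wt-sym G W xy)) w≡1

  adjacent-distinct : ∀ {x y} → adj G x y ≡ true → y ≢ x
  adjacent-distinct {x} xy refl with trans (sym xy) (irrefl G x)
  ... | ()

  edge-weight-bounds : ValidWeights G W → ∀ {a b} → adj G a b ≡ true →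
    0ℚ ≤ℚ wt W a b × wt W a b ≤ℚ 1ℚ
  edge-weight-bounds valid ab with orient G ab
  ... | inj₁ ab∈E rewrite proj₁ (wt-edge G W ab∈E) = valid ab∈E
  ... | inj₂ ba∈E rewrite proj₂ (wt-edge G W ba∈E) = valid ba∈E

  transfer-lost : ValidWeights G W → ∀ {a b} → adj G a b ≡ true → wt W a b ≢ 1ℚ →
    transfer (wt W a b) ≡ 0
  transfer-lost valid ab w≢1 with edge-weight-bounds valid ab
  ... | 0≤w , w≤1 = transfer-<1 0≤w (ℚP.≰⇒> (λ 1≤w → w≢1 (ℚP.≤-antisym w≤1 1≤w)))

  move-single : ∀ (C : Config n) {x b} (w : ℚ) → (∀ y → C y ≡ δ x y) → b ≢ x →
    ∀ y → move C x b 1 w y ≡ transfer w * δ b y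
  move-single C {x} {b} w C≗δx b≢x y with y ≟ x
  ... | yes refl rewrite C≗δx y | dec-true (y ≟ y) refl | dec-false (y ≟ b) (b≢x ∘ sym)
    = sym (ℕP.*-zeroʳ (transfer w))
  ... | no y≢x with y ≟ b
  ...   | yes refl rewrite C≗δx y | dec-false (y ≟ x) y≢x = sym (ℕP.*-identityʳ (transfer w))
  ...   | no y≢b rewrite C≗δx y | dec-false (y ≟ x) y≢x = sym (ℕP.*-zeroʳ (transfer w))

  -- Starting from one pebble on u, every reachable configuration is either
  -- empty or a lone pebble on a vertex joined to u by a path of full edges.
  LonePebble : Fin n → Config n → Set
  LonePebble u C = (∀ y → C y ≡ 0) ⊎ ∃ λ x → Star FullEdge u x × (∀ y → C y ≡ δ x y)

  -- A step from a lone pebble must move it (k = 1 from its vertex); it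
  -- survives exactly when the edge used is full.
  lone-step : ValidWeights G W → ∀ {u C C'} → Step G W C C' → LonePebble u C → LonePebble u C'
  lone-step valid (step C a b k ab 1≤k k≤Ca) (inj₁ empty)
    with ℕP.≤-trans 1≤k (subst (k ≤_) (empty a) k≤Ca)
  ... | ()
  lone-step valid (step C a b k ab 1≤k k≤Ca) (inj₂ (x , u⇝x , C≗δx)) with a ≟ x
  ... | no a≢x with ℕP.≤-trans 1≤k (subst (k ≤_) (trans (C≗δx a) (δ-other a≢x)) k≤Ca)
  ...   | ()
  lone-step valid (step C a b k ab 1≤k k≤Ca) (inj₂ (x , u⇝x , C≗δx)) | yes refl
    with ℕP.≤-antisym (subst (k ≤_) (trans (C≗δx a) (δ-self a)) k≤Ca) 1≤k
  ... | refl with ℚP._≟_ (wt W a b) 1ℚ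
  ...   | yes w≡1 = inj₂ (b , u⇝x ◅◅ ((ab , w≡1) ◅ ε) , λ y →
            trans (move-single C (wt W a b) C≗δx (adjacent-distinct ab) y)
                  (trans (cong (λ w → transfer w * δ b y) w≡1) (ℕP.*-identityˡ (δ b y))))
  ...   | no w≢1 = inj₁ λ y →
            trans (move-single C (wt W a b) C≗δx (adjacent-distinct ab) y)
                  (cong (_* δ b y) (transfer-lost valid ab w≢1))

  lone-steps : ValidWeights G W → ∀ {u C C'} → Star (Step G W) C C' →
    LonePebble u C → LonePebble u C'
  lone-steps valid ε lone = lone
  lone-steps valid (s ◅ ss) lone = lone-steps valid ss (lone-step valid s lone)

  solvable⇒full-paths : ValidWeights G W → Solvable G W 1 → ∀ u t → Star FullEdge u t
  solvable⇒full-paths valid solvable u t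
    with solvable (δ u) (trans (size≡∑ (δ u)) (∑-δ u)) t
  ... | C' , u⇝C' , 1≤C't with lone-steps valid u⇝C' (inj₂ (u , ε , λ _ → refl))
  ...   | inj₁ empty with subst (1 ≤_) (empty t) 1≤C't
  ...     | ()
  solvable⇒full-paths valid solvable u t | C' , u⇝C' , 1≤C't | inj₂ (x , u⇝x , C'≗δx) with t ≟ x
  ...     | yes refl = u⇝x
  ...     | no t≢x with subst (1 ≤_) (trans (C'≗δx t) (δ-other t≢x)) 1≤C't
  ...       | ()

  move-full : ∀ C {x y} → FullEdge x y → 1 ≤ move C x y 1 (wt W x y) y
  move-full C {x} {y} (xy , w≡1)
    rewrite dec-false (y ≟ x) (adjacent-distinct xy) | dec-true (y ≟ y) refl | w≡1 = ℕP.m≤n+m 1 (C y)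

  walk : ∀ {x t} → Star FullEdge x t → ∀ C → 1 ≤ C x → CanReach G W C t
  walk ε C 1≤Cx = C , ε , 1≤Cx
  walk {x} (_◅_ {j = y} xy y⇝t) C 1≤Cx with walk y⇝t (move C x y 1 (wt W x y)) (move-full C xy)
  ... | C' , steps , 1≤C't = C' , step C x y 1 (proj₁ xy) (s≤s z≤n) 1≤Cx ◅ steps , 1≤C't

  full-paths⇒solvable : (∀ u t → Star FullEdge u t) → Solvable G W 1
  full-paths⇒solvable paths C size≡1 t
    with ∑-pos C (subst (1 ≤_) (trans (sym size≡1) (size≡∑ C)) ℕP.≤-refl)
  ... | u , 1≤Cu = walk (paths u t) C 1≤Cu

module _ {n : ℕ} (G : Graph n) where

  private
    weight : Weights n → Fin n × Fin n → ℚ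
    weight W e = W (proj₁ e) (proj₂ e)

  -- Full edges weigh one each and no weight is negative, so at most
  -- |W| = |E|/2 edges are full.
  full-edge-count : ∀ W → ValidWeights G W → HalfWeight G W →
    2 * count (λ e → weight W e ℚP.≟ 1ℚ) (edges G) ≤ numEdges G
  full-edge-count W valid half = ι≤half⇒ ℓ (numEdges G) (begin
    ι ℓ                        ≡⟨ solve 2 (λ a b → a := a :* con 1ℚ :+ b :* con 0ℚ) refl (ι ℓ) (ι r) ⟩
    ι ℓ *ℚ 1ℚ +ℚ ι r *ℚ 0ℚ     ≡⟨ sumℚ-two-valued isOne? 1ℚ 0ℚ E ⟨
    sumℚ indicator E           ≤⟨ sumℚ-mono indicator (weight W) E indicator≤weight ⟩
    sumℚ (weight W) E          ≡⟨ half ⟩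
    + numEdges G / 2           ∎)
    where
    open ℚP.≤-Reasoning
    open +-*-Solver using (solve; _:=_; _:*_; _:+_; con)
    E = edges G
    isOne? = λ e → weight W e ℚP.≟ 1ℚ
    ℓ = count isOne? E
    r = count (¬? ∘ isOne?) E
    indicator : Fin n × Fin n → ℚ
    indicator e = if does (isOne? e) then 1ℚ else 0ℚ
    indicator≤weight : ∀ {e} → e ∈ E → indicator e ≤ℚ weight W e
    indicator≤weight {e} e∈E with isOne? e
    ... | yes w≡1 = ℚP.≤-reflexive (sym w≡1)
    ... | no _ = proj₁ (valid e∈E)

  -- Necessity: full edges connect all n vertices, so Kruskal keeps n − 1 of
  -- them; and at most |E|/2 edges are full.
  necessity : IsWP G 1 → 2 * n ∸ 2 ≤ numEdges G
  necessity (_ , (W , valid , half , solvable) , _) = begin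
    2 * n ∸ 2                           ≡⟨ ℕP.*-distribˡ-∸ 2 n 1 ⟨
    2 * (n ∸ 1)                         ≡⟨ cong (2 *_) (spanning-forest-size L single) ⟨
    2 * length (forestEdges (λ v → v) L)
      ≤⟨ ℕP.*-monoʳ-≤ 2 (length-mono-≤ (forest-sublist (λ v → v) L)) ⟩
    2 * length L                        ≤⟨ full-edge-count W valid half ⟩
    numEdges G                          ∎
    where
    open ℕP.≤-Reasoning
    isOne? = λ e → weight W e ℚP.≟ 1ℚ
    L = filter isOne? (edges G)
    final = forestLabel (λ v → v) L
    full-joined : ∀ {a b} → FullEdge G W a b → final a ≡ final b
    full-joined (ab , w≡1) with orient G ab
    ... | inj₁ ab∈E = forest-joins (λ v → v) L
                        (∈-filter⁺ isOne? ab∈E (trans (sym (proj₁ (wt-edge G W ab∈E))) w≡1))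
    ... | inj₂ ba∈E = sym (forest-joins (λ v → v) L
                        (∈-filter⁺ isOne? ba∈E (trans (sym (proj₂ (wt-edge G W ba∈E))) w≡1)))
    single : ∀ x y → final x ≡ final y
    single x y = star-joins final full-joined (solvable⇒full-paths G W valid solvable x y)

  spanningTree : List (Fin n × Fin n)
  spanningTree = forestEdges (λ v → v) (edges G)

  inTree? : Decidable (_∈ spanningTree)
  inTree? e = e ∈? spanningTree
    where open DecMembership (≡-dec _≟_ _≟_) using (_∈?_)

  treeWeights : ℚ → Weights n
  treeWeights c i j = if does (inTree? (i , j)) then 1ℚ else c

  connected⇒single-class : Connected G →
    ∀ x y → forestLabel (λ v → v) (edges G) x ≡ forestLabel (λ v → v) (edges G) y
  connected⇒single-class connected x y = star-joins final adjacent-joined (connected x y)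
    where
    final = forestLabel (λ v → v) (edges G)
    adjacent-joined : ∀ {a b} → adj G a b ≡ true → final a ≡ final b
    adjacent-joined ab with orient G ab
    ... | inj₁ ab∈E = forest-joins (λ v → v) (edges G) ab∈E
    ... | inj₂ ba∈E = sym (forest-joins (λ v → v) (edges G) ba∈E)

  -- With |E| ≥ 2n − 2, tree edges (n − 1 of them) are at most half of E.
  tree-minority : Connected G → 2 * n ∸ 2 ≤ numEdges G →
    count inTree? (edges G) ≤ count (¬? ∘ inTree?) (edges G)
  tree-minority connected enough = ℕP.+-cancelˡ-≤ t t r (begin
    t + t                   ≡⟨ cong (_+_ t) (ℕP.+-identityʳ t) ⟨
    2 * t                   ≤⟨ ℕP.*-monoʳ-≤ 2 t≤|T| ⟩
    2 * length spanningTree ≡⟨ cong (2 *_) (spanning-forest-size (edges G) (connected⇒single-class connected)) ⟩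
    2 * (n ∸ 1)             ≡⟨ ℕP.*-distribˡ-∸ 2 n 1 ⟩
    2 * n ∸ 2               ≤⟨ enough ⟩
    numEdges G              ≡⟨ count-split inTree? (edges G) ⟨
    t + r                   ∎)
    where
    open ℕP.≤-Reasoning
    t = count inTree? (edges G)
    r = count (¬? ∘ inTree?) (edges G)
    t≤|T| : t ≤ length spanningTree
    t≤|T| = count-∈-sublist (≡-dec _≟_ _≟_) (forest-sublist (λ v → v) (edges G)) (edges-unique G)

  tree-weights-valid : ∀ {c} → 0ℚ ≤ℚ c × c ≤ℚ 1ℚ → ValidWeights G (treeWeights c)
  tree-weights-valid {c} c-bounds {i} {j} _ with does (inTree? (i , j))
  ... | true = ℚP.nonNegative⁻¹ 1ℚ , ℚP.≤-refl
  ... | false = c-bounds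

  tree-weights-total : ∀ c → totalWeight G (treeWeights c) ≡
    ι (count inTree? (edges G)) *ℚ 1ℚ +ℚ ι (count (¬? ∘ inTree?) (edges G)) *ℚ c
  tree-weights-total c = sumℚ-two-valued inTree? 1ℚ c (edges G)

  -- The tree edges are full, and span the single final class.
  tree-weights-solvable : ∀ c → Connected G → Solvable G (treeWeights c) 1
  tree-weights-solvable c connected = full-paths⇒solvable G W λ x y →
    forest-spans (full-sym G W) (λ v → v) (edges G) (λ x y x≡y → subst (Star _ x) x≡y ε) tree-full
      x y (connected⇒single-class connected x y)
    where
    W = treeWeights c
    tree-full : ∀ {a b} → (a , b) ∈ spanningTree → FullEdge G W a b
    tree-full {a} {b} ab∈T = proj₂ (∈-edges⁻ G ab∈E) , trans (proj₁ (wt-edge G W ab∈E)) in-tree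
      where
      ab∈E = lookup (forest-sublist (λ v → v) (edges G)) ab∈T
      in-tree : W a b ≡ 1ℚ
      in-tree rewrite dec-true (inTree? (a , b)) ab∈T = refl

  sufficiency : Connected G → 2 * n ∸ 2 ≤ numEdges G → IsWP G 1
  sufficiency connected enough =
    s≤s z≤n , (treeWeights c , tree-weights-valid c-bounds , half , tree-weights-solvable c connected) ,
    below-one-impossible
    where
    t = count inTree? (edges G)
    r = count (¬? ∘ inTree?) (edges G)
    balancing = balancing-weight t r (tree-minority connected enough)
    c = proj₁ balancing
    c-bounds = proj₁ (proj₂ balancing)
    half : HalfWeight G (treeWeights c)
    half = trans (tree-weights-total c)
                 (trans (proj₂ (proj₂ balancing)) (cong (λ k → + k / 2) (count-split inTree? (edges G))))
    below-one-impossible : ∀ q → 1 ≤ q → suc q ≤ 1 → ¬ WSolvable G q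
    below-one-impossible q (s≤s _) (s≤s ())

proposition2 : ∀ (n : ℕ) (G : Graph n) → Connected G →
    (IsWP G 1 → 2 * n ∸ 2 ≤ numEdges G) × (2 * n ∸ 2 ≤ numEdges G → IsWP G 1)
proposition2 n G connected = necessity G , sufficiency G connected
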